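{- If the $p$-dimensional cubical category $\mathsf{Rel}$ has terminal objects that are stable under face maps and degeneracies, then for every $n\in\mathbb{N}$ there is a choice of terminal object $1_n$ in the category $|\mathsf{Rel}|^n\to\mathsf{Rel}$.
   Context: Fix a finitely complete, locally small category $\mathcal{C}$ and $p\in\mathbb{N}\cup\{\infty\}$; all categories, functors and natural transformations are internal to $\mathcal{C}$ ($\mathcal{X}_0,\mathcal{X}_1$ denote objects of objects/morphisms). The category $\square_p$ has objects the levels $l=\{0,\dots,l-1\}$, $l\le p$, and is generated by the face maps $\mathbf{f}_\star(l,k):l+1\to l$ ($\star\in\{\top,\bot\}$, $k\le l<p$; as a function $l+1\to l+\{\top,\bot\}$ it fixes $i<k$, sends $k\mapsto\star$, and $i\mapsto i-1$ for $i>k$) and the degeneracies $\mathbf{d}(l,k):l\to l+1$ ($k\le l<p$; fixes $i<k$, $i\mapsto i+1$ for $i\ge k$), with Kleisli composition in which $\top,\bot$ propagate. A $p$-dimensional cubical category is a functor $\square_p\to\mathsf{Cat}(\mathcal{C})$; $|\mathcal{X}|$ is its levelwise discrete version and $\mathcal{X}^n$ its levelwise $n$-fold power. A cubical functor $\mathcal{F}:\mathcal{X}\to\mathcal{Y}$ is a family of functors $\mathcal{F}(l):\mathcal{X}(l)\to\mathcal{Y}(l)$; it is face map-preserving if $\mathcal{Y}(h)\circ\mathcal{F}(l_1)=\mathcal{F}(l_2)\circ\mathcal{X}(h)$ for face maps $h:l_1\to l_2$, degeneracy-preserving if for degeneracies $h$ there are chosen natural isomorphisms $\varepsilon_\mathcal{F}(h):\mathcal{Y}(h)\circ\mathcal{F}(l_1)\to\mathcal{F}(l_2)\circ\mathcal{X}(h)$.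 A cubical natural transformation $\eta:\mathcal{F}\to\mathcal{G}$ is a family $\eta(l):\mathcal{F}(l)\to\mathcal{G}(l)$; face map-preserving: $\mathcal{Y}(h)(\eta(l_1)X)=\eta(l_2)(\mathcal{X}(h)X)$ for face maps $h$; degeneracy-preserving: $\eta(l_2)(\mathcal{X}(h)X)\circ\varepsilon_\mathcal{F}(h)X=\varepsilon_\mathcal{G}(h)X\circ\mathcal{Y}(h)(\eta(l_1)X)$ for degeneracies $h$. $\mathsf{Rel}$ is a $p$-dimensional cubical category with a class $M=\sum_{l\le p}M(l)$ of good isomorphisms (morphisms $J\to\mathsf{Rel}(l)_1$ of $\mathcal{C}$ that are isomorphisms in $\mathsf{Rel}(l)$; containing identities, closed under composition, inverses and reindexing). The category $|\mathsf{Rel}|^n\to\mathsf{Rel}$ has objects triples $(\mathcal{F},\varepsilon_\mathcal{F},\upsilon_\mathcal{F})$ with $\mathcal{F}:|\mathsf{Rel}|^n\to\mathsf{Rel}$ a face map-preserving cubical functor, $\varepsilon_\mathcal{F}$ witnessing degeneracy-preservation with $\varepsilon_\mathcal{F}(h)\in M(l_2)$ for each degeneracy $h:l_1\to l_2$, and $\upsilon_\mathcal{F}$ sending each isomorphism $f:\mathsf{Rel}(l)_0^m\to\mathsf{Rel}(l)_1^n$ with all components $\pi_k\circ f$ in $M(l)$ to an isomorphism $\upsilon_\mathcal{F}(f):\mathsf{Rel}(l)_0^m\to\mathsf{Rel}(l)_1$ in $M(l)$, compatibly with source, target, identities, composition and reindexing; morphisms are face map- and degeneracy-preserving cubical natural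 transformations. $\mathsf{Rel}$ has terminal objects if it comes with chosen terminal objects $1_l$ of $\mathsf{Rel}(l)$, $l\le p$; they are stable under face maps if $\mathsf{Rel}(h)1_{l_1}=1_{l_2}$ for every face map $h:l_1\to l_2$ of $\square_p$, and stable under degeneracies if this equality holds up to an isomorphism in $M(l_2)$ for every degeneracy $h:l_1\to l_2$. -}

module Defs where

open import Level using (Level; _⊔_) renaming (suc to lsuc)
open import Data.Nat using (ℕ; zero; suc; _≤_; _<_)
open import Data.Nat.Properties using (<⇒≤)
open import Data.Fin using (Fin; zero; suc)
open import Data.Bool using (Bool)
open import Data.Unit using (⊤; tt)
open import Data.Sum using (_⊎_; inj₁; inj₂; [_,_])
import Data.Sum as Sum
open import Data.Product using (Σ; _×_; _,_; proj₁; proj₂)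
open import Relation.Binary.PropositionalEquality
  using (_≡_; refl; sym; trans; cong; cong₂; module ≡-Reasoning)

record Category (o h : Level) : Set (lsuc (o ⊔ h)) where
  infixr 9 _∘_
  field
    Obj : Set o
    _⇒_ : Obj → Obj → Set h
    id  : ∀ {A} → A ⇒ A
    _∘_ : ∀ {A B C} → B ⇒ C → A ⇒ B → A ⇒ C
    identityˡ : ∀ {A B} {f : A ⇒ B} → id ∘ f ≡ f
    identityʳ : ∀ {A B} {f : A ⇒ B} → f ∘ id ≡ f
    assoc : ∀ {A B C D} {f : A ⇒ B} {g : B ⇒ C} {k : C ⇒ D} →
            (k ∘ g) ∘ f ≡ k ∘ (g ∘ f)

module _ {o h} (𝒞 : Category o h) where
  open Category 𝒞

  record Pullback {A B Z : Obj} (f : A ⇒ Z) (g : B ⇒ Z) : Set (o ⊔ h) where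
    field
      P  : Obj
      p₁ : P ⇒ A
      p₂ : P ⇒ B
      commute : f ∘ p₁ ≡ g ∘ p₂
      ⟨_,_⟩[_] : ∀ {J} (a : J ⇒ A) (b : J ⇒ B) → f ∘ a ≡ g ∘ b → J ⇒ P
      β₁ : ∀ {J} {a : J ⇒ A} {b : J ⇒ B} (e : f ∘ a ≡ g ∘ b) → p₁ ∘ ⟨ a , b ⟩[ e ] ≡ a
      β₂ : ∀ {J} {a : J ⇒ A} {b : J ⇒ B} (e : f ∘ a ≡ g ∘ b) → p₂ ∘ ⟨ a , b ⟩[ e ] ≡ b
      unique : ∀ {J} {a : J ⇒ A} {b : J ⇒ B} (e : f ∘ a ≡ g ∘ b) (u : J ⇒ P) →
               p₁ ∘ u ≡ a → p₂ ∘ u ≡ b → u ≡ ⟨ a , b ⟩[ e ]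

  record FinitelyComplete : Set (o ⊔ h) where
    field
      𝟙 : Obj
      ! : ∀ {A} → A ⇒ 𝟙
      !-unique : ∀ {A} (f : A ⇒ 𝟙) → f ≡ !
      pullback : ∀ {A B Z} (f : A ⇒ Z) (g : B ⇒ Z) → Pullback f g

-- The cube category □_p

data ℕ∞ : Set where
  fin : ℕ → ℕ∞
  ∞   : ℕ∞

_≤ₚ_ : ℕ → ℕ∞ → Set
l ≤ₚ fin p = l ≤ p
l ≤ₚ ∞     = ⊤

sucbound : ∀ {l} p → suc l ≤ₚ p → l ≤ₚ p
sucbound (fin p) q = <⇒≤ q
sucbound ∞ _ = tt

-- objects of □_p : levels l ≤ p
record Lv (p : ℕ∞) : Set where
  constructor lv
  field
    lvl : ℕ
    .bnd : lvl ≤ₚ p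
open Lv public

-- face map f_s(l,k) as a function l+1 → l + {⊤,⊥}  (k ≤ l, i.e. k : Fin (suc l))
faceFn : Bool → {l : ℕ} → Fin (suc l) → Fin (suc l) → Fin l ⊎ Bool
faceFn s zero zero = inj₂ s
faceFn s zero (suc j) = inj₁ j
faceFn s {zero} (suc ()) _
faceFn s {suc l} (suc k) zero = inj₁ zero
faceFn s {suc l} (suc k) (suc j) = Sum.map₁ suc (faceFn s k j)

-- degeneracy d(l,k) as a function l → l+1 (k ≤ l)
degFn : {l : ℕ} → Fin (suc l) → Fin l → Fin (suc l)
degFn zero i = suc i
degFn {zero} (suc ()) _
degFn {suc l} (suc k) zero = zero
degFn {suc l} (suc k) (suc i) = suc (degFn k i)

data Gen (p : ℕ∞) : Lv p → Lv p → Set where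
  face : (s : Bool) (l : ℕ) .(b : suc l ≤ₚ p) (k : Fin (suc l)) →
         Gen p (lv (suc l) b) (lv l (sucbound p b))
  deg  : (l : ℕ) .(b : suc l ≤ₚ p) (k : Fin (suc l)) →
         Gen p (lv l (sucbound p b)) (lv (suc l) b)

genFn : ∀ {p a b} → Gen p a b → Fin (lvl a) → Fin (lvl b) ⊎ Bool
genFn (face s l b k) = faceFn s k
genFn (deg l b k) i = inj₁ (degFn k i)

-- words in the generators (first generator applied first)
data Word (p : ℕ∞) : Lv p → Lv p → Set where
  []  : ∀ {a} → Word p a a
  _∷_ : ∀ {a b c} → Gen p a b → Word p b c → Word p a c

-- the morphism of □_p denoted by a word (Kleisli composition, ⊤/⊥ propagate)
⟦_⟧ : ∀ {p a b} → Word p a b → Fin (lvl a) → Fin (lvl b) ⊎ Bool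
⟦ [] ⟧ i = inj₁ i
⟦ g ∷ w ⟧ i = [ ⟦ w ⟧ , inj₂ ] (genFn g i)

-- Internal categories, functors, natural transformations in 𝒞

module _ {o h} {𝒞 : Category o h} (FC : FinitelyComplete 𝒞) where
  open Category 𝒞
  open FinitelyComplete FC
  open Pullback

  _×ₒ_ : Obj → Obj → Obj
  A ×ₒ B = P (pullback (! {A}) (! {B}))

  !-eq : ∀ {J A B} (a : J ⇒ A) (b : J ⇒ B) → ! ∘ a ≡ ! ∘ b
  !-eq a b = trans (!-unique _) (sym (!-unique _))

  pow : Obj → ℕ → Obj
  pow A zero = 𝟙
  pow A (suc n) = A ×ₒ pow A n

  proj : ∀ {A n} → Fin n → pow A n ⇒ A
  proj {A} {suc n} zero = p₁ (pullback (! {A}) (! {pow A n}))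
  proj {A} {suc n} (suc k) = proj k ∘ p₂ (pullback (! {A}) (! {pow A n}))

  tuple : ∀ {J A} n → (Fin n → J ⇒ A) → J ⇒ pow A n
  tuple zero fs = !
  tuple {J} {A} (suc n) fs =
    ⟨ pullback (! {A}) (! {pow A n}) , fs zero ⟩[ tuple n (λ k → fs (suc k)) ]
      (!-eq _ _)

  powMap : ∀ {A B} n → A ⇒ B → pow A n ⇒ pow B n
  powMap n u = tuple n (λ k → u ∘ proj k)

  record IntCat : Set (o ⊔ h) where
    field
      Ob Mor : Obj
      src tgt : Mor ⇒ Ob
      idn : Ob ⇒ Mor
      comp : P (pullback tgt src) ⇒ Mor

    -- f then g
    compose : ∀ {J} (f g : J ⇒ Mor) → tgt ∘ f ≡ src ∘ g → J ⇒ Mor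
    compose f g e = comp ∘ ⟨ pullback tgt src , f ⟩[ g ] e

    field
      src-idn : src ∘ idn ≡ id
      tgt-idn : tgt ∘ idn ≡ id
      src-comp : ∀ {J} {f g : J ⇒ Mor} (e : tgt ∘ f ≡ src ∘ g) →
                 src ∘ compose f g e ≡ src ∘ f
      tgt-comp : ∀ {J} {f g : J ⇒ Mor} (e : tgt ∘ f ≡ src ∘ g) →
                 tgt ∘ compose f g e ≡ tgt ∘ g
      unitˡ : ∀ {J} {f : J ⇒ Mor} (e : tgt ∘ (idn ∘ src ∘ f) ≡ src ∘ f) →
              compose (idn ∘ src ∘ f) f e ≡ f
      unitʳ : ∀ {J} {f : J ⇒ Mor} (e : tgt ∘ f ≡ src ∘ (idn ∘ tgt ∘ f)) →
              compose f (idn ∘ tgt ∘ f) e ≡ f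
      assocᵢ : ∀ {J} {f g k : J ⇒ Mor} (e₁ : tgt ∘ f ≡ src ∘ g)
               (e₂ : tgt ∘ compose f g e₁ ≡ src ∘ k) (e₃ : tgt ∘ g ≡ src ∘ k)
               (e₄ : tgt ∘ f ≡ src ∘ compose g k e₃) →
               compose (compose f g e₁) k e₂ ≡ compose f (compose g k e₃) e₄

  open IntCat

  record IsInverse (X : IntCat) {J : Obj} (f g : J ⇒ Mor X) : Set h where
    field
      fg : tgt X ∘ f ≡ src X ∘ g
      gf : tgt X ∘ g ≡ src X ∘ f
      fg-id : ∀ e → compose X f g e ≡ idn X ∘ src X ∘ f
      gf-id : ∀ e → compose X g f e ≡ idn X ∘ tgt X ∘ f

  IsIso : (X : IntCat) {J : Obj} (f : J ⇒ Mor X) → Set h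
  IsIso X {J} f = Σ (J ⇒ Mor X) (IsInverse X f)

  record IntFunctor (X Y : IntCat) : Set (o ⊔ h) where
    field
      F₀ : Ob X ⇒ Ob Y
      F₁ : Mor X ⇒ Mor Y
      F-src : src Y ∘ F₁ ≡ F₀ ∘ src X
      F-tgt : tgt Y ∘ F₁ ≡ F₀ ∘ tgt X
      F-idn : F₁ ∘ idn X ≡ idn Y ∘ F₀
      F-comp : ∀ {J} {f g : J ⇒ Mor X} (e : tgt X ∘ f ≡ src X ∘ g)
               (e' : tgt Y ∘ (F₁ ∘ f) ≡ src Y ∘ (F₁ ∘ g)) →
               F₁ ∘ compose X f g e ≡ compose Y (F₁ ∘ f) (F₁ ∘ g) e'
  open IntFunctor

  _≈F_ : ∀ {X Y} → IntFunctor X Y → IntFunctor X Y → Set h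
  F ≈F G = (F₀ F ≡ F₀ G) × (F₁ F ≡ F₁ G)

  record NatTrans {X Y : IntCat} (F G : IntFunctor X Y) : Set (o ⊔ h) where
    field
      α : Ob X ⇒ Mor Y
      α-src : src Y ∘ α ≡ F₀ F
      α-tgt : tgt Y ∘ α ≡ F₀ G
      natural : ∀ {J} (f : J ⇒ Mor X)
                (e : tgt Y ∘ (α ∘ src X ∘ f) ≡ src Y ∘ (F₁ G ∘ f))
                (e' : tgt Y ∘ (F₁ F ∘ f) ≡ src Y ∘ (α ∘ tgt X ∘ f)) →
                compose Y (α ∘ src X ∘ f) (F₁ G ∘ f) e
                  ≡ compose Y (F₁ F ∘ f) (α ∘ tgt X ∘ f) e'
  open NatTrans

  pair-irr : ∀ {A B Z J} {f : A ⇒ Z} {g : B ⇒ Z} (pb : Pullback 𝒞 f g)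
             {a : J ⇒ A} {b : J ⇒ B} (e e' : f ∘ a ≡ g ∘ b) →
             ⟨ pb , a ⟩[ b ] e ≡ ⟨ pb , a ⟩[ b ] e'
  pair-irr pb e e' = unique pb e' _ (β₁ pb e) (β₂ pb e)

  compose-cong : ∀ (X : IntCat) {J} {f f' g g' : J ⇒ Mor X} → f ≡ f' → g ≡ g' →
                 ∀ e e' → compose X f g e ≡ compose X f' g' e'
  compose-cong X refl refl e e' = cong (comp X ∘_) (pair-irr (pullback (tgt X) (src X)) e e')

  F-pres : ∀ {X Y} (F : IntFunctor X Y) {J} {f g : J ⇒ Mor X} →
           tgt X ∘ f ≡ src X ∘ g → tgt Y ∘ (F₁ F ∘ f) ≡ src Y ∘ (F₁ F ∘ g)
  F-pres {X} {Y} F {f = f} {g} e = begin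
      tgt Y ∘ (F₁ F ∘ f)   ≡⟨ sym assoc ⟩
      (tgt Y ∘ F₁ F) ∘ f   ≡⟨ cong (_∘ f) (F-tgt F) ⟩
      (F₀ F ∘ tgt X) ∘ f   ≡⟨ assoc ⟩
      F₀ F ∘ (tgt X ∘ f)   ≡⟨ cong (F₀ F ∘_) e ⟩
      F₀ F ∘ (src X ∘ g)   ≡⟨ sym assoc ⟩
      (F₀ F ∘ src X) ∘ g   ≡⟨ cong (_∘ g) (sym (F-src F)) ⟩
      (src Y ∘ F₁ F) ∘ g   ≡⟨ assoc ⟩
      src Y ∘ (F₁ F ∘ g)   ∎
    where open ≡-Reasoning

  idF : ∀ {X} → IntFunctor X X
  idF {X} = record
    { F₀ = id ; F₁ = id
    ; F-src = trans identityʳ (sym identityˡ)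
    ; F-tgt = trans identityʳ (sym identityˡ)
    ; F-idn = trans identityˡ (sym identityʳ)
    ; F-comp = λ e e' → trans identityˡ (compose-cong X (sym identityˡ) (sym identityˡ) e e')
    }

  _∘F_ : ∀ {X Y Z} → IntFunctor Y Z → IntFunctor X Y → IntFunctor X Z
  _∘F_ {X} {Y} {Z} G F = record
    { F₀ = F₀ G ∘ F₀ F
    ; F₁ = F₁ G ∘ F₁ F
    ; F-src = lem {src Z} {src Y} {src X} (F-src G) (F-src F)
    ; F-tgt = lem {tgt Z} {tgt Y} {tgt X} (F-tgt G) (F-tgt F)
    ; F-idn = trans assoc (trans (cong (F₁ G ∘_) (F-idn F))
               (trans (sym assoc) (trans (cong (_∘ F₀ F) (F-idn G)) assoc)))
    ; F-comp = λ {J} {f} {g} e e' → begin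
        (F₁ G ∘ F₁ F) ∘ compose X f g e
          ≡⟨ assoc ⟩
        F₁ G ∘ (F₁ F ∘ compose X f g e)
          ≡⟨ cong (F₁ G ∘_) (F-comp F e (F-pres F e)) ⟩
        F₁ G ∘ compose Y (F₁ F ∘ f) (F₁ F ∘ g) (F-pres F e)
          ≡⟨ F-comp G (F-pres F e) (F-pres G (F-pres F e)) ⟩
        compose Z (F₁ G ∘ (F₁ F ∘ f)) (F₁ G ∘ (F₁ F ∘ g)) (F-pres G (F-pres F e))
          ≡⟨ compose-cong Z (sym assoc) (sym assoc) _ e' ⟩
        compose Z ((F₁ G ∘ F₁ F) ∘ f) ((F₁ G ∘ F₁ F) ∘ g) e' ∎
    }
    where
      open ≡-Reasoning
      lem : ∀ {a : Mor Z ⇒ Ob Z} {b : Mor Y ⇒ Ob Y} {c : Mor X ⇒ Ob X} → a ∘ F₁ G ≡ F₀ G ∘ b → b ∘ F₁ F ≡ F₀ F ∘ c →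
            a ∘ (F₁ G ∘ F₁ F) ≡ (F₀ G ∘ F₀ F) ∘ c
      lem {a} {b} {c} p q = begin
        a ∘ (F₁ G ∘ F₁ F)   ≡⟨ sym assoc ⟩
        (a ∘ F₁ G) ∘ F₁ F   ≡⟨ cong (_∘ F₁ F) p ⟩
        (F₀ G ∘ b) ∘ F₁ F   ≡⟨ assoc ⟩
        F₀ G ∘ (b ∘ F₁ F)   ≡⟨ cong (F₀ G ∘_) q ⟩
        F₀ G ∘ (F₀ F ∘ c)   ≡⟨ sym assoc ⟩
        (F₀ G ∘ F₀ F) ∘ c   ∎

  Disc : Obj → IntCat
  Disc A = record
    { Ob = A ; Mor = A ; src = id ; tgt = id ; idn = id
    ; comp = p₁ (pullback id id)
    ; src-idn = identityˡ ; tgt-idn = identityˡ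
    ; src-comp = λ e → cong (id ∘_) (β₁ pb e)
    ; tgt-comp = λ e → trans (cong (id ∘_) (β₁ pb e)) e
    ; unitˡ = λ e → trans (β₁ pb e) (trans identityˡ identityˡ)
    ; unitʳ = λ e → β₁ pb e
    ; assocᵢ = λ e₁ e₂ e₃ e₄ → trans (β₁ pb e₂) (trans (β₁ pb e₁) (sym (β₁ pb e₄)))
    }
    where pb = pullback (id {A}) (id {A})

  DiscF : ∀ {A B} → A ⇒ B → IntFunctor (Disc A) (Disc B)
  DiscF {A} {B} u = record
    { F₀ = u ; F₁ = u
    ; F-src = trans identityˡ (sym identityʳ)
    ; F-tgt = trans identityˡ (sym identityʳ)
    ; F-idn = trans identityʳ (sym identityˡ)
    ; F-comp = λ e e' → trans (cong (u ∘_) (β₁ (pullback id id) e))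
                              (sym (β₁ (pullback id id) e'))
    }

  -- p-dimensional cubical categories: functors □_p → Cat(𝒞)

  actW : ∀ {p} (cat : Lv p → IntCat) (gen : ∀ {a b} → Gen p a b → IntFunctor (cat a) (cat b)) →
         ∀ {a b} → Word p a b → IntFunctor (cat a) (cat b)
  actW cat gen [] = idF
  actW cat gen (g ∷ w) = actW cat gen w ∘F gen g

  record CubicalCat (p : ℕ∞) : Set (o ⊔ h) where
    field
      cat : Lv p → IntCat
      gen : ∀ {a b} → Gen p a b → IntFunctor (cat a) (cat b)

    act : ∀ {a b} → Word p a b → IntFunctor (cat a) (cat b)
    act = actW cat gen

    field
      act-resp : ∀ {a b} (w w' : Word p a b) → (∀ i → ⟦ w ⟧ i ≡ ⟦ w' ⟧ i) →
                 act w ≈F act w'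
  open CubicalCat

  module _ {p : ℕ∞} (X : CubicalCat p) where

    record GoodIsos : Set (lsuc (o ⊔ h)) where
      field
        M : (a : Lv p) {J : Obj} → J ⇒ Mor (cat X a) → Set (o ⊔ h)
        M-prop : ∀ a {J} {f : J ⇒ Mor (cat X a)} (x y : M a f) → x ≡ y
        M-iso : ∀ a {J} {f : J ⇒ Mor (cat X a)} → M a f → IsIso (cat X a) f
        M-id : ∀ a {J} (x : J ⇒ Ob (cat X a)) → M a (idn (cat X a) ∘ x)
        M-comp : ∀ a {J} {f g : J ⇒ Mor (cat X a)} (e : tgt (cat X a) ∘ f ≡ src (cat X a) ∘ g) →
                 M a f → M a g → M a (compose (cat X a) f g e)
        M-inv : ∀ a {J} {f g : J ⇒ Mor (cat X a)} → M a f → IsInverse (cat X a) f g → M a g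
        M-reindex : ∀ a {J J'} {f : J ⇒ Mor (cat X a)} (r : J' ⇒ J) → M a f → M a (f ∘ r)

    IsTerminalIn : (Y : IntCat) → 𝟙 ⇒ Ob Y → Set (o ⊔ h)
    IsTerminalIn Y t = ∀ {J} (x : J ⇒ Ob Y) →
      Σ (J ⇒ Mor Y) λ u → (src Y ∘ u ≡ x) × (tgt Y ∘ u ≡ t ∘ !) ×
        (∀ u' → src Y ∘ u' ≡ x → tgt Y ∘ u' ≡ t ∘ ! → u' ≡ u)

    record Terminals : Set (o ⊔ h) where
      field
        one : (a : Lv p) → 𝟙 ⇒ Ob (cat X a)
        one-terminal : ∀ a → IsTerminalIn (cat X a) (one a)
    open Terminals

    StableFaces : Terminals → Set h
    StableFaces T = ∀ (s : Bool) (l : ℕ) .(b : suc l ≤ₚ p) (k : Fin (suc l)) →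
      F₀ (gen X (face s l b k)) ∘ one T (lv (suc l) b) ≡ one T (lv l (sucbound p b))

    StableDegs : GoodIsos → Terminals → Set (o ⊔ h)
    StableDegs 𝕄 T = ∀ (l : ℕ) .(b : suc l ≤ₚ p) (k : Fin (suc l)) →
      Σ (𝟙 ⇒ Mor (cat X (lv (suc l) b))) λ u →
        GoodIsos.M 𝕄 (lv (suc l) b) u ×
        (src (cat X (lv (suc l) b)) ∘ u ≡ F₀ (gen X (deg l b k)) ∘ one T (lv l (sucbound p b))) ×
        (tgt (cat X (lv (suc l) b)) ∘ u ≡ one T (lv (suc l) b))

    -- the category |X|^n → X

    module _ (𝕄 : GoodIsos) (n : ℕ) where
      open GoodIsos 𝕄

      PowC : Lv p → IntCat
      PowC a = Disc (pow (Ob (cat X a)) n)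

      powF : ∀ {a b} → Gen p a b → IntFunctor (PowC a) (PowC b)
      powF h = DiscF (powMap n (F₀ (gen X h)))

      Ob⁼ Mor⁼ : Lv p → ℕ → Obj
      Ob⁼ a m = pow (Ob (cat X a)) m
      Mor⁼ a m = pow (Mor (cat X a)) m

      AllM : ∀ a m → Ob⁼ a m ⇒ Mor⁼ a n → Set (o ⊔ h)
      AllM a m f = ∀ (i : Fin n) → M a (proj {n = n} i ∘ f)

      record RelFun : Set (o ⊔ h) where
        field
          F : (a : Lv p) → IntFunctor (PowC a) (cat X a)
          face-pres : ∀ (s : Bool) (l : ℕ) .(b : suc l ≤ₚ p) (k : Fin (suc l)) →
            (gen X (face s l b k) ∘F F (lv (suc l) b))
              ≈F (F (lv l (sucbound p b)) ∘F powF (face s l b k))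
          ε : ∀ (l : ℕ) .(b : suc l ≤ₚ p) (k : Fin (suc l)) →
            NatTrans (gen X (deg l b k) ∘F F (lv l (sucbound p b)))
                     (F (lv (suc l) b) ∘F powF (deg l b k))
          ε-good : ∀ (l : ℕ) .(b : suc l ≤ₚ p) (k : Fin (suc l)) →
            M (lv (suc l) b) (α (ε l b k))
          υ : ∀ (a : Lv p) (m : ℕ) (f : Ob⁼ a m ⇒ Mor⁼ a n) → AllM a m f → Ob⁼ a m ⇒ Mor (cat X a)
          υ-good : ∀ a m (f : Ob⁼ a m ⇒ Mor⁼ a n) (mf : AllM a m f) → M a (υ a m f mf)
          υ-src : ∀ a m (f : Ob⁼ a m ⇒ Mor⁼ a n) (mf : AllM a m f) →
            src (cat X a) ∘ υ a m f mf ≡ F₀ (F a) ∘ (powMap n (src (cat X a)) ∘ f)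
          υ-tgt : ∀ a m (f : Ob⁼ a m ⇒ Mor⁼ a n) (mf : AllM a m f) →
            tgt (cat X a) ∘ υ a m f mf ≡ F₀ (F a) ∘ (powMap n (tgt (cat X a)) ∘ f)
          υ-id : ∀ a m (x : Ob⁼ a m ⇒ Ob⁼ a n) (mf : AllM a m (powMap n (idn (cat X a)) ∘ x)) →
            υ a m (powMap n (idn (cat X a)) ∘ x) mf ≡ idn (cat X a) ∘ (F₀ (F a) ∘ x)
          υ-comp : ∀ a m (f g : Ob⁼ a m ⇒ Mor⁼ a n) (mf : AllM a m f) (mg : AllM a m g)
            (e : ∀ (i : Fin n) → tgt (cat X a) ∘ (proj {n = n} i ∘ f) ≡ src (cat X a) ∘ (proj {n = n} i ∘ g))
            (mfg : AllM a m (tuple n (λ j → compose (cat X a) (proj {n = n} j ∘ f) (proj {n = n} j ∘ g) (e j))))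
            (e' : tgt (cat X a) ∘ υ a m f mf ≡ src (cat X a) ∘ υ a m g mg) →
            υ a m (tuple n (λ j → compose (cat X a) (proj {n = n} j ∘ f) (proj {n = n} j ∘ g) (e j))) mfg
              ≡ compose (cat X a) (υ a m f mf) (υ a m g mg) e'
          υ-reindex : ∀ a m m' (f : Ob⁼ a m ⇒ Mor⁼ a n) (mf : AllM a m f)
            (r : Ob⁼ a m' ⇒ Ob⁼ a m) (mfr : AllM a m' (f ∘ r)) →
            υ a m' (f ∘ r) mfr ≡ υ a m f mf ∘ r
      open RelFun

      record RelHom (𝔽 𝔾 : RelFun) : Set (o ⊔ h) where
        field
          η : (a : Lv p) → NatTrans (F 𝔽 a) (F 𝔾 a)
          η-face : ∀ (s : Bool) (l : ℕ) .(b : suc l ≤ₚ p) (k : Fin (suc l)) →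
            F₁ (gen X (face s l b k)) ∘ α (η (lv (suc l) b))
              ≡ α (η (lv l (sucbound p b))) ∘ powMap n (F₀ (gen X (face s l b k)))
          η-deg : ∀ (l : ℕ) .(b : suc l ≤ₚ p) (k : Fin (suc l))
            (e : tgt (cat X (lv (suc l) b)) ∘ α (ε 𝔽 l b k)
                   ≡ src (cat X (lv (suc l) b)) ∘ (α (η (lv (suc l) b)) ∘ powMap n (F₀ (gen X (deg l b k)))))
            (e' : tgt (cat X (lv (suc l) b)) ∘ (F₁ (gen X (deg l b k)) ∘ α (η (lv l (sucbound p b))))
                   ≡ src (cat X (lv (suc l) b)) ∘ α (ε 𝔾 l b k)) →
            compose (cat X (lv (suc l) b)) (α (ε 𝔽 l b k))
                    (α (η (lv (suc l) b)) ∘ powMap n (F₀ (gen X (deg l b k)))) e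
              ≡ compose (cat X (lv (suc l) b))
                    (F₁ (gen X (deg l b k)) ∘ α (η (lv l (sucbound p b)))) (α (ε 𝔾 l b k)) e'
      open RelHom

      _≈H_ : ∀ {𝔽 𝔾} → RelHom 𝔽 𝔾 → RelHom 𝔽 𝔾 → Set h
      φ ≈H ψ = ∀ a → α (η φ a) ≡ α (η ψ a)

      IsTerminalRelFun : RelFun → Set (o ⊔ h)
      IsTerminalRelFun 𝕋 = ∀ (𝔾 : RelFun) →
        Σ (RelHom 𝔾 𝕋) λ φ → ∀ (ψ : RelHom 𝔾 𝕋) → ψ ≈H φ

      TerminalRelFun : Set (o ⊔ h)
      TerminalRelFun = Σ RelFun IsTerminalRelFun

-- The constant functor at the chosen terminal objects is terminal. An arrow of
-- an internal category whose target is the terminal object is determined by its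
-- source. So every coherence required of the constant functor (functoriality,
-- naturality, the laws of υ) and of the cone into it is an equation between
-- such arrows, and it reduces to comparing sources. Stability under face maps
-- makes the constant functor strictly face map-preserving. Stability under
-- degeneracies supplies the good isomorphisms ε. The unique map into the
-- terminal object supplies both the cone and its uniqueness.
module Submission where

open import Defs
open import Data.Nat using (ℕ; suc)
open import Data.Product using (_,_; proj₁; proj₂)
open import Relation.Binary.PropositionalEquality
  using (_≡_; refl; sym; trans; cong)

module _ {o h} {𝒞 : Category o h} (FC : FinitelyComplete 𝒞) where
  open Category 𝒞
  open FinitelyComplete FC
  open IntCat
  open IntFunctor
  open NatTrans

  ∘-!-unique : ∀ {J A} (t : 𝟙 ⇒ A) (g : J ⇒ 𝟙) → t ∘ g ≡ t ∘ !
  ∘-!-unique t g = cong (t ∘_) (!-unique g)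

  ∘-!-absorb : ∀ {J K A} (t : 𝟙 ⇒ A) (g : J ⇒ K) → (t ∘ !) ∘ g ≡ t ∘ !
  ∘-!-absorb t g = trans assoc (∘-!-unique t _)

  module _ {X Y : IntCat FC} (H : IntFunctor FC X Y) {J : Obj} (u : J ⇒ Mor X) where

    src-F₁ : src Y ∘ (F₁ H ∘ u) ≡ F₀ H ∘ (src X ∘ u)
    src-F₁ = trans (sym assoc) (trans (cong (_∘ u) (F-src H)) assoc)

    tgt-F₁ : tgt Y ∘ (F₁ H ∘ u) ≡ F₀ H ∘ (tgt X ∘ u)
    tgt-F₁ = trans (sym assoc) (trans (cong (_∘ u) (F-tgt H)) assoc)

  module Terminal {p} (X : CubicalCat FC p) {Y : IntCat FC} {t : 𝟙 ⇒ Ob Y}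
                  (t-terminal : IsTerminalIn FC X Y t) where

    !ₜ : ∀ {J} → J ⇒ Ob Y → J ⇒ Mor Y
    !ₜ x = proj₁ (t-terminal x)

    src-!ₜ : ∀ {J} (x : J ⇒ Ob Y) → src Y ∘ !ₜ x ≡ x
    src-!ₜ x = proj₁ (proj₂ (t-terminal x))

    tgt-!ₜ : ∀ {J} (x : J ⇒ Ob Y) → tgt Y ∘ !ₜ x ≡ t ∘ !
    tgt-!ₜ x = proj₁ (proj₂ (proj₂ (t-terminal x)))

    src-!ₜ-∘ : ∀ {J K} (x : J ⇒ Ob Y) (g : K ⇒ J) → src Y ∘ (!ₜ x ∘ g) ≡ x ∘ g
    src-!ₜ-∘ x g = trans (sym assoc) (cong (_∘ g) (src-!ₜ x))

    tgt-!ₜ-∘ : ∀ {J K} (x : J ⇒ Ob Y) (g : K ⇒ J) → tgt Y ∘ (!ₜ x ∘ g) ≡ t ∘ !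
    tgt-!ₜ-∘ x g = trans (sym assoc) (trans (cong (_∘ g) (tgt-!ₜ x)) (∘-!-absorb t g))

    !ₜ-unique : ∀ {J} {x : J ⇒ Ob Y} (u : J ⇒ Mor Y) →
                src Y ∘ u ≡ x → tgt Y ∘ u ≡ t ∘ ! → u ≡ !ₜ x
    !ₜ-unique {x = x} = proj₂ (proj₂ (proj₂ (t-terminal x)))

    terminal-ext : ∀ {J} {u₁ u₂ : J ⇒ Mor Y} → src Y ∘ u₁ ≡ src Y ∘ u₂ →
                   tgt Y ∘ u₁ ≡ t ∘ ! → tgt Y ∘ u₂ ≡ t ∘ ! → u₁ ≡ u₂
    terminal-ext {u₁ = u₁} {u₂} s t₁ t₂ =
      trans (!ₜ-unique u₁ s t₁) (sym (!ₜ-unique u₂ refl t₂))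

    compose-terminal-ext :
      ∀ {J} {f g f' g' : J ⇒ Mor Y} (e : tgt Y ∘ f ≡ src Y ∘ g) (e' : tgt Y ∘ f' ≡ src Y ∘ g') →
      src Y ∘ f ≡ src Y ∘ f' → tgt Y ∘ g ≡ t ∘ ! → tgt Y ∘ g' ≡ t ∘ ! →
      compose Y f g e ≡ compose Y f' g' e'
    compose-terminal-ext e e' s t₁ t₂ =
      terminal-ext (trans (src-comp Y e) (trans s (sym (src-comp Y e'))))
                   (trans (tgt-comp Y e) t₁) (trans (tgt-comp Y e') t₂)

    idₜ : ∀ {J} → J ⇒ Mor Y
    idₜ = idn Y ∘ (t ∘ !)

    src-idₜ : ∀ {J} → src Y ∘ idₜ {J} ≡ t ∘ !
    src-idₜ = trans (sym assoc) (trans (cong (_∘ _) (src-idn Y)) identityˡ)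

    tgt-idₜ : ∀ {J} → tgt Y ∘ idₜ {J} ≡ t ∘ !
    tgt-idₜ = trans (sym assoc) (trans (cong (_∘ _) (tgt-idn Y)) identityˡ)

    idₜ-∘ : ∀ {J K} (g : J ⇒ K) → idₜ ∘ g ≡ idₜ
    idₜ-∘ g = trans assoc (cong (idn Y ∘_) (∘-!-absorb t g))

    constF : (Z : IntCat FC) → IntFunctor FC Z Y
    constF Z = record
      { F₀ = t ∘ !
      ; F₁ = idₜ
      ; F-src = trans src-idₜ (sym (∘-!-absorb t (src Z)))
      ; F-tgt = trans tgt-idₜ (sym (∘-!-absorb t (tgt Z)))
      ; F-idn = idₜ-∘ (idn Z)
      ; F-comp = λ {_} {f} {g} e e' → terminal-ext
          (trans (cong (src Y ∘_) (idₜ-∘ _))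
            (trans src-idₜ (sym (trans (src-comp Y e') (trans (cong (src Y ∘_) (idₜ-∘ f)) src-idₜ)))))
          (trans (cong (tgt Y ∘_) (idₜ-∘ _)) tgt-idₜ)
          (trans (tgt-comp Y e') (trans (cong (tgt Y ∘_) (idₜ-∘ g)) tgt-idₜ))
      }

    -- Naturality is automatic when the target functor is constant at t.
    natTransIntoConst : ∀ {Z : IntCat FC} (G K : IntFunctor FC Z Y) → F₀ K ≡ t ∘ ! →
      (a : Ob Z ⇒ Mor Y) → src Y ∘ a ≡ F₀ G → tgt Y ∘ a ≡ F₀ K → NatTrans FC G K
    natTransIntoConst {Z} G K K-const a a-src a-tgt = record
      { α = a
      ; α-src = a-src
      ; α-tgt = a-tgt
      ; natural = λ f e e' → compose-terminal-ext e e'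
          (trans (sym assoc) (trans (cong (_∘ (src Z ∘ f)) a-src) (sym (src-F₁ G f))))
          (trans (tgt-F₁ K f) (K-after (tgt Z ∘ f)))
          (trans (sym assoc) (trans (cong (_∘ (tgt Z ∘ f)) a-tgt) (K-after (tgt Z ∘ f))))
      }
      where
        K-after : ∀ {J} (g : J ⇒ Ob Z) → F₀ K ∘ g ≡ t ∘ !
        K-after g = trans (cong (_∘ g) K-const) (∘-!-absorb t g)

    toConst : ∀ {Z : IntCat FC} (G : IntFunctor FC Z Y) → NatTrans FC G (constF Z)
    toConst G = natTransIntoConst G (constF _) refl (!ₜ (F₀ G)) (src-!ₜ (F₀ G)) (tgt-!ₜ (F₀ G))

  module _ {p} (Rel : CubicalCat FC p) (𝕄 : GoodIsos FC Rel) (T : Terminals FC Rel)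
           (stable-faces : StableFaces FC Rel T) (stable-degs : StableDegs FC Rel 𝕄 T)
           (n : ℕ) where
    open CubicalCat Rel
    open GoodIsos 𝕄
    open Terminals T
    open RelFun
    open RelHom

    module At (a : Lv p) = Terminal Rel {cat a} {one a} (one-terminal a)
    open At using (!ₜ; idₜ; src-idₜ; tgt-idₜ; idₜ-∘; terminal-ext; compose-terminal-ext)

    const : ∀ a → IntFunctor FC (PowC FC Rel 𝕄 n a) (cat a)
    const a = At.constF a _

    face-one : ∀ s l .(b : suc l ≤ₚ p) k {J} (g : J ⇒ 𝟙) →
      F₀ (gen (face s l b k)) ∘ (one (lv (suc l) b) ∘ g) ≡ one (lv l (sucbound p b)) ∘ !
    face-one s l b k g =
      trans (sym assoc) (trans (cong (_∘ g) (stable-faces s l b k)) (∘-!-unique _ g))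

    const-face : ∀ s l .(b : suc l ≤ₚ p) k →
      _≈F_ FC (_∘F_ FC (gen (face s l b k)) (const (lv (suc l) b)))
              (_∘F_ FC (const (lv l (sucbound p b))) (powF FC Rel 𝕄 n (face s l b k)))
    const-face s l b k =
        trans (face-one s l b k !) (sym (∘-!-absorb _ _))
      , terminal-ext L
          (trans (src-F₁ H (idₜ S)) (trans (cong (F₀ H ∘_) (src-idₜ S))
            (trans (face-one s l b k !) (sym (trans (cong (src (cat L) ∘_) (idₜ-∘ L _)) (src-idₜ L))))))
          (trans (tgt-F₁ H (idₜ S)) (trans (cong (F₀ H ∘_) (tgt-idₜ S)) (face-one s l b k !)))
          (trans (cong (tgt (cat L) ∘_) (idₜ-∘ L _)) (tgt-idₜ L))
      where
        S = lv (suc l) b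
        L = lv l (sucbound p b)
        H = gen (face s l b k)

    const-deg : ∀ l .(b : suc l ≤ₚ p) k →
      NatTrans FC (_∘F_ FC (gen (deg l b k)) (const (lv l (sucbound p b))))
                  (_∘F_ FC (const (lv (suc l) b)) (powF FC Rel 𝕄 n (deg l b k)))
    const-deg l b k = At.natTransIntoConst S (_∘F_ FC (gen (deg l b k)) (const (lv l (sucbound p b))))
                                         (_∘F_ FC (const S) (powF FC Rel 𝕄 n (deg l b k)))
                                         (∘-!-absorb _ _) (u ∘ !)
      (trans (sym assoc) (trans (cong (_∘ !) u-src) assoc))
      (trans (sym assoc) (trans (cong (_∘ !) u-tgt) (sym (∘-!-absorb _ _))))
      where
        S = lv (suc l) b
        u = proj₁ (stable-degs l b k)
        u-src = proj₁ (proj₂ (proj₂ (stable-degs l b k)))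
        u-tgt = proj₂ (proj₂ (proj₂ (stable-degs l b k)))

    constRelFun : RelFun FC Rel 𝕄 n
    constRelFun = record
      { F = const
      ; face-pres = const-face
      ; ε = const-deg
      ; ε-good = λ l b k → M-reindex _ ! (proj₁ (proj₂ (stable-degs l b k)))
      ; υ = λ a _ _ _ → idₜ a
      ; υ-good = λ a _ _ _ → M-id a _
      ; υ-src = λ a _ _ _ → trans (src-idₜ a) (sym (∘-!-absorb _ _))
      ; υ-tgt = λ a _ _ _ → trans (tgt-idₜ a) (sym (∘-!-absorb _ _))
      ; υ-id = λ a _ _ _ → cong (idn (cat a) ∘_) (sym (∘-!-absorb _ _))
      ; υ-comp = λ a _ _ _ _ _ _ _ e' → terminal-ext a
          (trans (src-idₜ a) (sym (trans (src-comp (cat a) e') (src-idₜ a))))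
          (tgt-idₜ a) (trans (tgt-comp (cat a) e') (tgt-idₜ a))
      ; υ-reindex = λ a _ _ _ _ r _ → sym (idₜ-∘ a r)
      }

    module _ (𝔾 : RelFun FC Rel 𝕄 n) where

      toOne : ∀ a → Ob (PowC FC Rel 𝕄 n a) ⇒ Mor (cat a)
      toOne a = !ₜ a (F₀ (F 𝔾 a))

      cone : RelHom FC Rel 𝕄 n 𝔾 constRelFun
      cone = record
        { η = λ a → At.toConst a (F 𝔾 a)
        ; η-face = λ s l b k →
            let S = lv (suc l) b ; L = lv l (sucbound p b) ; H = gen (face s l b k) in
            terminal-ext L
              (trans (src-F₁ H (toOne S)) (trans (cong (F₀ H ∘_) (At.src-!ₜ S (F₀ (F 𝔾 S))))
                (trans (proj₁ (face-pres 𝔾 s l b k))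
                  (sym (At.src-!ₜ-∘ L (F₀ (F 𝔾 L)) (powMap FC n (F₀ H)))))))
              (trans (tgt-F₁ H (toOne S)) (trans (cong (F₀ H ∘_) (At.tgt-!ₜ S (F₀ (F 𝔾 S)))) (face-one s l b k !)))
              (At.tgt-!ₜ-∘ L (F₀ (F 𝔾 L)) (powMap FC n (F₀ H)))
        ; η-deg = λ l b k e e' →
            let S = lv (suc l) b ; L = lv l (sucbound p b) ; H = gen (deg l b k) in
            compose-terminal-ext S e e'
              (trans (α-src (ε 𝔾 l b k))
                (sym (trans (src-F₁ H (toOne L)) (cong (F₀ H ∘_) (At.src-!ₜ L (F₀ (F 𝔾 L)))))))
              (At.tgt-!ₜ-∘ S (F₀ (F 𝔾 S)) (powMap FC n (F₀ H)))
              (trans (α-tgt (const-deg l b k)) (∘-!-absorb _ _))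
        }

      cone-unique : ∀ (ψ : RelHom FC Rel 𝕄 n 𝔾 constRelFun) → _≈H_ FC Rel 𝕄 n ψ cone
      cone-unique ψ a = At.!ₜ-unique a (α (η ψ a)) (α-src (η ψ a)) (α-tgt (η ψ a))

    constRelFun-terminal : IsTerminalRelFun FC Rel 𝕄 n constRelFun
    constRelFun-terminal 𝔾 = cone 𝔾 , cone-unique 𝔾

lemma13 : ∀ {o h} {𝒞 : Category o h} (FC : FinitelyComplete 𝒞) (p : ℕ∞)
    (Rel : CubicalCat FC p) (𝕄 : GoodIsos FC Rel) (T : Terminals FC Rel) →
    StableFaces FC Rel T → StableDegs FC Rel 𝕄 T →
    (n : ℕ) → TerminalRelFun FC Rel 𝕄 n
lemma13 FC p Rel 𝕄 T sf sd n =
  constRelFun FC Rel 𝕄 T sf sd n , constRelFun-terminal FC Rel 𝕄 T sf sd n
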